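{- For every large $n$ there is a set $E$ of $n$ points in $\mathbb{R}^5$ such that the number of tuples $(x_1,x_2,x_3,x_4)\in E^4$ with $\angle(x_1,x_2,x_3)=\angle(x_2,x_3,x_4)=\pi/2$ is $\approx n^4$.
   Context: $\angle(x,y,z)\in[0,\pi]$ denotes the angle at $y$ between $x-y$ and $z-y$ (for $x\ne y\ne z$). $X\approx Y$ means $c Y\le X\le CY$ for all $n>N$ with positive constants $c,C,N$ independent of $n$. -}

module Defs where

open import Level using (0ℓ)
open import Data.Nat as ℕ using (ℕ; zero; suc)
open import Data.Fin using (Fin)
open import Data.Vec using (Vec; zipWith; foldr; tabulate; lookup)
open import Data.Vec.Properties using (≡-dec)
open import Data.Sum using (_⊎_)
open import Data.Product using (Σ; ∃; _×_; _,_)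
open import Relation.Nullary using (¬_; Dec; yes; no)
open import Relation.Nullary.Decidable using (_×-dec_; ¬?)
open import Relation.Binary.PropositionalEquality using (_≡_)
open import Relation.Binary.Structures using (IsStrictTotalOrder)
open import Algebra.Structures using (IsCommutativeRing)

-- The real numbers, given axiomatically as a complete ordered field
-- (any two models are isomorphic, so quantifying over all models is the
-- same as speaking about ℝ).
record RealField : Set₁ where
  infixl 6 _+_
  infixl 7 _*_
  infix 4 _<_ _≤_
  field
    Carrier : Set
    _+_ _*_ : Carrier → Carrier → Carrier
    -_      : Carrier → Carrier
    0r 1r   : Carrier
    _<_     : Carrier → Carrier → Set
    isCommutativeRing : IsCommutativeRing _≡_ _+_ _*_ -_ 0r 1r
    0≢1     : ¬ (0r ≡ 1r)
    inverse : ∀ x → ¬ (x ≡ 0r) → ∃ λ y → x * y ≡ 1r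
    isStrictTotalOrder : IsStrictTotalOrder _≡_ _<_
    +-mono-< : ∀ {x y} z → x < y → x + z < y + z
    *-pos    : ∀ {x y} → 0r < x → 0r < y → 0r < x * y
  _≤_ : Carrier → Carrier → Set
  x ≤ y = (x < y) ⊎ (x ≡ y)
  field
    complete : (P : Carrier → Set) → (∃ λ x → P x) → (∃ λ b → ∀ x → P x → x ≤ b) →
               ∃ λ s → (∀ x → P x → x ≤ s) × (∀ b → (∀ x → P x → x ≤ b) → s ≤ b)

  _-_ : Carrier → Carrier → Carrier
  x - y = x + (- y)

  _≟_ : (x y : Carrier) → Dec (x ≡ y)
  _≟_ = IsStrictTotalOrder._≟_ isStrictTotalOrder

  fromℕ : ℕ → Carrier
  fromℕ zero    = 0r
  fromℕ (suc n) = 1r + fromℕ n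

module Geometry (ℝ : RealField) where
  open RealField ℝ

  Point : ℕ → Set
  Point d = Vec Carrier d

  _⊖_ : ∀ {d} → Point d → Point d → Point d
  _⊖_ = zipWith _-_

  dot : ∀ {d} → Point d → Point d → Carrier
  dot u v = foldr _ _+_ 0r (zipWith _*_ u v)

  _≟ᵖ_ : ∀ {d} (x y : Point d) → Dec (x ≡ y)
  _≟ᵖ_ = ≡-dec _≟_

  -- ∠(x,y,z) = π/2 : the angle at y is defined (x ≠ y ≠ z) and equals
  -- arccos( (x-y)·(z-y) / (|x-y||z-y|) ) = π/2, i.e. the dot product vanishes.
  RightAngle : ∀ {d} → Point d → Point d → Point d → Set
  RightAngle x y z = ¬ (x ≡ y) × ¬ (z ≡ y) × dot (x ⊖ y) (z ⊖ y) ≡ 0r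

  rightAngle? : ∀ {d} (x y z : Point d) → Dec (RightAngle x y z)
  rightAngle? x y z = ¬? (x ≟ᵖ y) ×-dec ¬? (z ≟ᵖ y) ×-dec (dot (x ⊖ y) (z ⊖ y) ≟ 0r)

sumFin : (n : ℕ) → (Fin n → ℕ) → ℕ
sumFin n f = foldr _ ℕ._+_ 0 (tabulate f)

indicator : ∀ {P : Set} → Dec P → ℕ
indicator (yes _) = 1
indicator (no _)  = 0

module Counting (ℝ : RealField) where
  open RealField ℝ public
  open Geometry ℝ public

  -- number of (x₁,x₂,x₃,x₄) ∈ E⁴ with ∠(x₁,x₂,x₃) = ∠(x₂,x₃,x₄) = π/2,
  -- where E = {E i | i : Fin n} (E injective).
  rightPathCount : ∀ {d n} → (Fin n → Point d) → ℕ
  rightPathCount {d} {n} E =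
    sumFin n λ i → sumFin n λ j → sumFin n λ k → sumFin n λ l →
      indicator (rightAngle? (E i) (E j) (E k) ×-dec rightAngle? (E j) (E k) (E l))

-- Four families of points, indexed by k ∈ ℕ, with (x_k, y_k) = (1 - k², 2k) / (1 + k²) on the unit circle:
--   A_k = (-1, 0, 0, 0, k+1),  B_k = (x_k, y_k, 0, 0, 0),  C_k = (1, 0, 1 + x_k, y_k, 0),  D_k = (1, 0, 2, 0, k+1).
-- Every (A, B, C, D) is a right path by Thales' theorem: A and C project onto the plane of the B-circle at the
-- ends (∓1, 0) of a diameter and their components orthogonal to that plane are orthogonal to each other; in the
-- same way B and D project onto the plane of the C-circle at the ends of a diameter. Dealing n ≥ 4 points
-- cyclically to the four families gives each family at least n/7 points, hence at least (n/7)⁴ right paths,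
-- and trivially there are at most n⁴.

module Submission where

open import Defs
open import Data.Nat as ℕ using (ℕ; zero; suc; z≤n; s≤s; _>_; _^_)
import Data.Nat.Properties as ℕ
open import Data.Integer as ℤ using (ℤ; -[1+_]; +[1+_]; 0ℤ; 1ℤ; -1ℤ)
import Data.Integer.Properties as ℤ
open import Data.Maybe using (Maybe; just; nothing)
open import Data.Fin using (Fin; toℕ) renaming (zero to fzero; suc to fsuc)
import Data.Fin.Properties as Fin
open import Data.Fin.Patterns using (0F; 1F; 2F; 3F; 4F)
open import Data.Vec using (_∷_; []; lookup)
open import Function using (_∘_)
open import Function.Definitions using (Injective)
open import Data.Product using (∃; _×_; _,_; proj₁; proj₂)
open import Data.Sum using (inj₁; inj₂)
open import Data.Empty using (⊥-elim)
open import Relation.Nullary using (¬_; Dec; yes; no)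
open import Relation.Nullary.Decidable using (_×-dec_)
open import Relation.Binary.Definitions using (tri<; tri≈; tri>)
open import Relation.Binary.Structures using (IsStrictTotalOrder)
open import Relation.Binary.PropositionalEquality as ≡ using (_≡_; refl; sym; trans; cong; cong₂; subst; subst₂; module ≡-Reasoning)
open import Algebra.Bundles using (CommutativeRing)
open import Algebra.Solver.Ring.AlmostCommutativeRing using (_-Raw-AlmostCommutative⟶_; fromCommutativeRing)
import Algebra.Solver.Ring

-- The carrier of an abstract ring has no computable equality, so the ring solver takes its coefficients from ℤ.
module IntegerCoefficients {c ℓ} (R : CommutativeRing c ℓ) where
  open CommutativeRing R renaming (refl to ≈-refl; sym to ≈-sym; trans to ≈-trans)
  open import Algebra.Properties.Semiring.Mult.TCOptimised semiring using (1+×; ×-homo-+; ×1-homo-*)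
    renaming (_×_ to _×′_)
  open import Algebra.Properties.Ring ring using (-‿distribˡ-*; -‿distribʳ-*)
  open import Algebra.Properties.AbelianGroup +-abelianGroup using (⁻¹-∙-comm; ε⁻¹≈ε; ⁻¹-involutive)
  open import Algebra.Properties.CommutativeSemigroup +-commutativeSemigroup using (interchange)
  open import Relation.Binary.Reasoning.Setoid setoid

  ⟦_⟧ : ℤ → Carrier
  ⟦ ℤ.+ n ⟧    = n ×′ 1#
  ⟦ -[1+ n ] ⟧ = - (suc n ×′ 1#)

  ⊖-homo : ∀ m n → ⟦ m ℤ.⊖ n ⟧ ≈ m ×′ 1# - n ×′ 1#
  ⊖-homo m       zero    = ≈-sym (≈-trans (+-congˡ ε⁻¹≈ε) (+-identityʳ _))
  ⊖-homo zero    (suc n) = ≈-sym (+-identityˡ _)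
  ⊖-homo (suc m) (suc n) = begin
    ⟦ suc m ℤ.⊖ suc n ⟧        ≡⟨ ≡.cong ⟦_⟧ (ℤ.[1+m]⊖[1+n]≡m⊖n m n) ⟩
    ⟦ m ℤ.⊖ n ⟧                ≈⟨ ⊖-homo m n ⟩
    M - N                      ≈⟨ +-identityˡ (M - N) ⟨
    0# + (M - N)               ≈⟨ +-congʳ (-‿inverseʳ 1#) ⟨
    (1# - 1#) + (M - N)        ≈⟨ interchange 1# (- 1#) M (- N) ⟩
    (1# + M) + (- 1# - N)      ≈⟨ +-congˡ (⁻¹-∙-comm 1# N) ⟩
    (1# + M) - (1# + N)        ≈⟨ +-cong (1+× m 1#) (-‿cong (1+× n 1#)) ⟨
    suc m ×′ 1# - suc n ×′ 1#  ∎
    where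
    M N : Carrier
    M = m ×′ 1#
    N = n ×′ 1#

  -‿homo : ∀ i → ⟦ ℤ.- i ⟧ ≈ - ⟦ i ⟧
  -‿homo (ℤ.+ zero) = ≈-sym ε⁻¹≈ε
  -‿homo +[1+ n ]   = ≈-refl
  -‿homo -[1+ n ]   = ≈-sym (⁻¹-involutive _)

  +-homo : ∀ i j → ⟦ i ℤ.+ j ⟧ ≈ ⟦ i ⟧ + ⟦ j ⟧
  +-homo (ℤ.+ m)  (ℤ.+ n)  = ×-homo-+ 1# m n
  +-homo (ℤ.+ m)  -[1+ n ] = ⊖-homo m (suc n)
  +-homo -[1+ m ] (ℤ.+ n)  = ≈-trans (⊖-homo n (suc m)) (+-comm _ _)
  +-homo -[1+ m ] -[1+ n ] = begin
    ⟦ -[1+ m ] ℤ.+ -[1+ n ] ⟧        ≡⟨ ≡.cong ⟦_⟧ (ℤ.neg-distrib-+ +[1+ m ] +[1+ n ]) ⟨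
    ⟦ ℤ.- (+[1+ m ] ℤ.+ +[1+ n ]) ⟧  ≈⟨ -‿homo (+[1+ m ] ℤ.+ +[1+ n ]) ⟩
    - ⟦ +[1+ m ] ℤ.+ +[1+ n ] ⟧      ≈⟨ -‿cong (+-homo +[1+ m ] +[1+ n ]) ⟩
    - (⟦ +[1+ m ] ⟧ + ⟦ +[1+ n ] ⟧)  ≈⟨ ⁻¹-∙-comm _ _ ⟨
    ⟦ -[1+ m ] ⟧ + ⟦ -[1+ n ] ⟧      ∎

  *-homo-+ : ∀ m j → ⟦ ℤ.+ m ℤ.* j ⟧ ≈ ⟦ ℤ.+ m ⟧ * ⟦ j ⟧
  *-homo-+ m (ℤ.+ n)  = ≈-trans (reflexive (≡.cong ⟦_⟧ (≡.sym (ℤ.pos-* m n)))) (×1-homo-* m n)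
  *-homo-+ m -[1+ n ] = begin
    ⟦ ℤ.+ m ℤ.* -[1+ n ] ⟧        ≡⟨ ≡.cong ⟦_⟧ (ℤ.neg-distribʳ-* (ℤ.+ m) +[1+ n ]) ⟨
    ⟦ ℤ.- (ℤ.+ m ℤ.* +[1+ n ]) ⟧  ≈⟨ -‿homo (ℤ.+ m ℤ.* +[1+ n ]) ⟩
    - ⟦ ℤ.+ m ℤ.* +[1+ n ] ⟧      ≈⟨ -‿cong (*-homo-+ m +[1+ n ]) ⟩
    - (⟦ ℤ.+ m ⟧ * ⟦ +[1+ n ] ⟧)  ≈⟨ -‿distribʳ-* _ _ ⟩
    ⟦ ℤ.+ m ⟧ * ⟦ -[1+ n ] ⟧      ∎

  *-homo : ∀ i j → ⟦ i ℤ.* j ⟧ ≈ ⟦ i ⟧ * ⟦ j ⟧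
  *-homo (ℤ.+ m)  j = *-homo-+ m j
  *-homo -[1+ m ] j = begin
    ⟦ -[1+ m ] ℤ.* j ⟧        ≡⟨ ≡.cong ⟦_⟧ (ℤ.neg-distribˡ-* +[1+ m ] j) ⟨
    ⟦ ℤ.- (+[1+ m ] ℤ.* j) ⟧  ≈⟨ -‿homo (+[1+ m ] ℤ.* j) ⟩
    - ⟦ +[1+ m ] ℤ.* j ⟧      ≈⟨ -‿cong (*-homo-+ (suc m) j) ⟩
    - (⟦ +[1+ m ] ⟧ * ⟦ j ⟧)  ≈⟨ -‿distribˡ-* _ _ ⟩
    ⟦ -[1+ m ] ⟧ * ⟦ j ⟧      ∎

  homomorphism : ℤ.+-*-rawRing -Raw-AlmostCommutative⟶ fromCommutativeRing R
  homomorphism = record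
    { ⟦_⟧    = ⟦_⟧
    ; +-homo = +-homo
    ; *-homo = *-homo
    ; -‿homo = -‿homo
    ; 0-homo = ≈-refl
    ; 1-homo = ≈-refl
    }

  ⟦⟧-≟ : ∀ i j → Maybe (⟦ i ⟧ ≈ ⟦ j ⟧)
  ⟦⟧-≟ i j with i ℤ.≟ j
  ... | yes refl = just ≈-refl
  ... | no _     = nothing

  open Algebra.Solver.Ring ℤ.+-*-rawRing (fromCommutativeRing R) homomorphism ⟦⟧-≟ public
    using (solve; _:=_; _:+_; _:*_; _:-_; :-_; con)

module OrderedFieldProperties (ℝ : RealField) where
  open RealField ℝ
  open IsStrictTotalOrder isStrictTotalOrder using (compare) renaming (trans to <-trans; irrefl to <-irrefl)

  commutativeRing : CommutativeRing _ _
  commutativeRing = record { isCommutativeRing = isCommutativeRing }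

  open CommutativeRing commutativeRing public
    using (+-identityˡ; +-identityʳ; *-identityˡ; *-identityʳ; +-comm; -‿inverseʳ; zeroʳ; semiring)

  open IntegerCoefficients commutativeRing public using (solve; _:=_; _:+_; _:*_; _:-_; :-_; con)
  open import Algebra.Properties.Semiring.Mult semiring using (×1-homo-*) renaming (_×_ to _×ᵤ_)

  <-irreflexive : ∀ {x} → ¬ (x < x)
  <-irreflexive = <-irrefl refl

  0<⇒≢0 : ∀ {x} → 0r < x → ¬ (x ≡ 0r)
  0<⇒≢0 0<x x≡0 = <-irreflexive (subst (0r <_) x≡0 0<x)

  x<y⇒0<y-x : ∀ {x y} → x < y → 0r < y - x
  x<y⇒0<y-x {x} {y} x<y = subst (_< y - x) (-‿inverseʳ x) (+-mono-< (- x) x<y)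

  x<0⇒0<-x : ∀ {x} → x < 0r → 0r < - x
  x<0⇒0<-x {x} x<0 = subst (0r <_) (+-identityˡ (- x)) (x<y⇒0<y-x x<0)

  0<x⇒y<x+y : ∀ {x} y → 0r < x → y < x + y
  0<x⇒y<x+y y 0<x = subst (_< _ + y) (+-identityˡ y) (+-mono-< y 0<x)

  0<x∧0≤y⇒0<x+y : ∀ {x y} → 0r < x → 0r ≤ y → 0r < x + y
  0<x∧0≤y⇒0<x+y 0<x (inj₁ 0<y) = <-trans 0<y (0<x⇒y<x+y _ 0<x)
  0<x∧0≤y⇒0<x+y {x} 0<x (inj₂ refl) = subst (0r <_) (sym (+-identityʳ x)) 0<x

  0<x⇒¬0<-x : ∀ {x} → 0r < x → ¬ (0r < - x)
  0<x⇒¬0<-x {x} 0<x 0<-x = <-irreflexive (subst (0r <_) (-‿inverseʳ x) (0<x∧0≤y⇒0<x+y 0<x (inj₁ 0<-x)))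

  -x*-y≡x*y : ∀ x y → (- x) * (- y) ≡ x * y
  -x*-y≡x*y = solve 2 (λ x y → (:- x) :* (:- y) := x :* y) refl

  0<1 : 0r < 1r
  0<1 with compare 0r 1r
  ... | tri< 0<1 _ _ = 0<1
  ... | tri≈ _ 0≡1 _ = ⊥-elim (0≢1 0≡1)
  ... | tri> _ _ 1<0 = ⊥-elim (0<x⇒¬0<-x 0<1′ 0<-1)
    where
    0<-1 : 0r < - 1r
    0<-1 = x<0⇒0<-x 1<0
    0<1′ : 0r < 1r
    0<1′ = subst (0r <_) (trans (-x*-y≡x*y 1r 1r) (*-identityˡ 1r)) (*-pos 0<-1 0<-1)

  0≤x*x : ∀ x → 0r ≤ x * x
  0≤x*x x with compare 0r x
  ... | tri< 0<x _ _ = inj₁ (*-pos 0<x 0<x)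
  ... | tri≈ _ refl _ = inj₂ (sym (zeroʳ 0r))
  ... | tri> _ _ x<0 = inj₁ (subst (0r <_) (-x*-y≡x*y x x) (*-pos (x<0⇒0<-x x<0) (x<0⇒0<-x x<0)))

  0≤fromℕ : ∀ n → 0r ≤ fromℕ n
  0≤fromℕ zero    = inj₂ refl
  0≤fromℕ (suc n) = inj₁ (0<x∧0≤y⇒0<x+y 0<1 (0≤fromℕ n))

  0<fromℕ-suc : ∀ n → 0r < fromℕ (suc n)
  0<fromℕ-suc n = 0<x∧0≤y⇒0<x+y 0<1 (0≤fromℕ n)

  0<fromℕ : ∀ {n} → 0 ℕ.< n → 0r < fromℕ n
  0<fromℕ {suc n} _ = 0<fromℕ-suc n

  0<2 : 0r < 1r + 1r
  0<2 = 0<x∧0≤y⇒0<x+y 0<1 (inj₁ 0<1)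

  -1≢1 : ¬ (- 1r ≡ 1r)
  -1≢1 -1≡1 = 0<⇒≢0 0<2 (trans (cong (1r +_) (sym -1≡1)) (-‿inverseʳ 1r))

  +-cancelˡ : ∀ x {y z} → x + y ≡ x + z → y ≡ z
  +-cancelˡ x {y} {z} eq = begin
    y             ≡⟨ solve 2 (λ x y → y := (:- x) :+ (x :+ y)) refl x y ⟩
    - x + (x + y) ≡⟨ cong ((- x) +_) eq ⟩
    - x + (x + z) ≡⟨ solve 2 (λ x z → (:- x) :+ (x :+ z) := z) refl x z ⟩
    z             ∎
    where open ≡-Reasoning

  fromℕ-injective : ∀ {m n} → fromℕ m ≡ fromℕ n → m ≡ n
  fromℕ-injective {zero}  {zero}  _  = refl
  fromℕ-injective {zero}  {suc n} eq = ⊥-elim (0<⇒≢0 (0<fromℕ-suc n) (sym eq))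
  fromℕ-injective {suc m} {zero}  eq = ⊥-elim (0<⇒≢0 (0<fromℕ-suc m) eq)
  fromℕ-injective {suc m} {suc n} eq = cong suc (fromℕ-injective (+-cancelˡ 1r eq))

  *-cancelˡ : ∀ {x y z} → ¬ (x ≡ 0r) → x * y ≡ x * z → y ≡ z
  *-cancelˡ {x} {y} {z} x≢0 eq with inverse x x≢0
  ... | x⁻¹ , x*x⁻¹≡1 = begin
    y             ≡⟨ sym (x⁻¹*[x*y]≡y y) ⟩
    x⁻¹ * (x * y) ≡⟨ cong (x⁻¹ *_) eq ⟩
    x⁻¹ * (x * z) ≡⟨ x⁻¹*[x*y]≡y z ⟩
    z             ∎
    where
    open ≡-Reasoning
    x⁻¹*[x*y]≡y : ∀ y → x⁻¹ * (x * y) ≡ y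
    x⁻¹*[x*y]≡y y = begin
      x⁻¹ * (x * y) ≡⟨ solve 3 (λ x x⁻¹ y → x⁻¹ :* (x :* y) := (x :* x⁻¹) :* y) refl x x⁻¹ y ⟩
      (x * x⁻¹) * y ≡⟨ cong (_* y) x*x⁻¹≡1 ⟩
      1r * y        ≡⟨ *-identityˡ y ⟩
      y             ∎

  +-monoʳ-≤ : ∀ x {y z} → y ≤ z → x + y ≤ x + z
  +-monoʳ-≤ x {y} {z} (inj₁ y<z) = inj₁ (subst₂ _<_ (+-comm y x) (+-comm z x) (+-mono-< x y<z))
  +-monoʳ-≤ x (inj₂ refl) = inj₂ refl

  fromℕ-mono-≤ : ∀ {m n} → m ℕ.≤ n → fromℕ m ≤ fromℕ n
  fromℕ-mono-≤ {n = n} z≤n = 0≤fromℕ n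
  fromℕ-mono-≤ (s≤s m≤n) = +-monoʳ-≤ 1r (fromℕ-mono-≤ m≤n)

  *-monoʳ-≤ : ∀ {x y z} → 0r < x → y ≤ z → x * y ≤ x * z
  *-monoʳ-≤ {x} {y} {z} 0<x (inj₁ y<z) =
    inj₁ (subst (x * y <_) x[z-y]+xy≡xz (0<x⇒y<x+y (x * y) (*-pos 0<x (x<y⇒0<y-x y<z))))
    where
    x[z-y]+xy≡xz : x * (z - y) + x * y ≡ x * z
    x[z-y]+xy≡xz = solve 3 (λ x y z → x :* (z :- y) :+ x :* y := x :* z) refl x y z
  *-monoʳ-≤ 0<x (inj₂ refl) = inj₂ refl

  positiveInverse : ∀ {x} → 0r < x → ∃ λ y → 0r < y × x * y ≡ 1r
  positiveInverse {x} 0<x with inverse x (0<⇒≢0 0<x)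
  ... | y , x*y≡1 = y , 0<y , x*y≡1
    where
    0<y : 0r < y
    0<y with compare 0r y
    ... | tri< 0<y _ _ = 0<y
    ... | tri≈ _ refl _ = ⊥-elim (0≢1 (trans (sym (zeroʳ x)) x*y≡1))
    ... | tri> _ _ y<0 = ⊥-elim (0<x⇒¬0<-x 0<1 (subst (0r <_) x*-y≡-1 (*-pos 0<x (x<0⇒0<-x y<0))))
      where
      x*-y≡-1 : x * (- y) ≡ - 1r
      x*-y≡-1 = trans (solve 2 (λ x y → x :* (:- y) := :- (x :* y)) refl x y) (cong -_ x*y≡1)

  fromℕ≡×1 : ∀ n → fromℕ n ≡ n ×ᵤ 1r
  fromℕ≡×1 zero    = refl
  fromℕ≡×1 (suc n) = cong (1r +_) (fromℕ≡×1 n)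

  fromℕ-* : ∀ m n → fromℕ (m ℕ.* n) ≡ fromℕ m * fromℕ n
  fromℕ-* m n = begin
    fromℕ (m ℕ.* n)        ≡⟨ fromℕ≡×1 (m ℕ.* n) ⟩
    (m ℕ.* n) ×ᵤ 1r        ≡⟨ ×1-homo-* m n ⟩
    (m ×ᵤ 1r) * (n ×ᵤ 1r)  ≡⟨ sym (cong₂ _*_ (fromℕ≡×1 m) (fromℕ≡×1 n)) ⟩
    fromℕ m * fromℕ n      ∎
    where open ≡-Reasoning

  fromℕ-≤-rescale : ∀ {c k m r} → 0r < c → fromℕ k * c ≡ 1r → m ℕ.≤ r ℕ.* k → c * fromℕ m ≤ fromℕ r
  fromℕ-≤-rescale {c} {k} {m} {r} 0<c kc≡1 m≤rk =
    subst (c * fromℕ m ≤_) c*rk≡r (*-monoʳ-≤ 0<c (fromℕ-mono-≤ m≤rk))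
    where
    c*rk≡r : c * fromℕ (r ℕ.* k) ≡ fromℕ r
    c*rk≡r = begin
      c * fromℕ (r ℕ.* k)        ≡⟨ cong (c *_) (fromℕ-* r k) ⟩
      c * (fromℕ r * fromℕ k)    ≡⟨ solve 3 (λ c r k → c :* (r :* k) := r :* (k :* c)) refl c (fromℕ r) (fromℕ k) ⟩
      fromℕ r * (fromℕ k * c)    ≡⟨ cong (fromℕ r *_) kc≡1 ⟩
      fromℕ r * 1r               ≡⟨ *-identityʳ (fromℕ r) ⟩
      fromℕ r                    ∎
      where open ≡-Reasoning

module _ where
  open import Data.Nat using (_≤_; _*_; _+_)

  sumFin-≤-* : ∀ n {f : Fin n → ℕ} {b} → (∀ i → f i ≤ b) → sumFin n f ≤ n * b
  sumFin-≤-* zero    f≤b = z≤n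
  sumFin-≤-* (suc n) f≤b = ℕ.+-mono-≤ (f≤b fzero) (sumFin-≤-* n (f≤b ∘ fsuc))

  countFin : ∀ {n} {P : Fin n → Set} → (∀ i → Dec (P i)) → ℕ
  countFin {n} P? = sumFin n (λ i → indicator (P? i))

  indicator-≤-1 : ∀ {P : Set} (P? : Dec P) → indicator P? ≤ 1
  indicator-≤-1 (yes _) = ℕ.≤-refl
  indicator-≤-1 (no _)  = z≤n

  indicator-≥-1 : ∀ {P : Set} (P? : Dec P) → P → 1 ≤ indicator P?
  indicator-≥-1 (yes _) _ = ℕ.≤-refl
  indicator-≥-1 (no ¬p) p = ⊥-elim (¬p p)

  indicator-*-≤ : ∀ {P : Set} (P? : Dec P) {g x} → (P → g ≤ x) → indicator P? * g ≤ x
  indicator-*-≤ (yes p) {g} g≤x = subst (_≤ _) (sym (ℕ.+-identityʳ g)) (g≤x p)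
  indicator-*-≤ (no _)      _   = z≤n

  countFin-*-≤-sumFin : ∀ n {P : Fin n → Set} (P? : ∀ i → Dec (P i)) {g} {f : Fin n → ℕ} →
                        (∀ i → P i → g ≤ f i) → countFin P? * g ≤ sumFin n f
  countFin-*-≤-sumFin zero    P? g≤f = z≤n
  countFin-*-≤-sumFin (suc n) P? {g} {f} g≤f = begin
    countFin P? * g                                      ≡⟨ ℕ.*-distribʳ-+ g (indicator (P? fzero)) (countFin (P? ∘ fsuc)) ⟩
    indicator (P? fzero) * g + countFin (P? ∘ fsuc) * g  ≤⟨ ℕ.+-mono-≤ (indicator-*-≤ (P? fzero) (g≤f fzero))
                                                                         (countFin-*-≤-sumFin n (P? ∘ fsuc) (g≤f ∘ fsuc)) ⟩
    f fzero + sumFin n (f ∘ fsuc)                        ∎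
    where open ℕ.≤-Reasoning

  *-mono-≤-rescale : ∀ {m n a b k l} → m ≤ a * k → n ≤ b * l → m * n ≤ (a * b) * (k * l)
  *-mono-≤-rescale {a = a} {b} {k} {l} m≤ak n≤bl =
    ℕ.≤-trans (ℕ.*-mono-≤ m≤ak n≤bl) (ℕ.≤-reflexive (ℕ.[m*n]*[o*p]≡[m*o]*[n*p] a k b l))

  ^4-≤-rescale : ∀ {n k a b c d} → n ≤ a * k → n ≤ b * k → n ≤ c * k → n ≤ d * k →
                 n ℕ.^ 4 ≤ (a * (b * (c * (d * 1)))) * k ℕ.^ 4
  ^4-≤-rescale {k = k} {a} {b} {c} {d} n≤ak n≤bk n≤ck n≤dk =
    *-mono-≤-rescale {a = a} {b * (c * (d * 1))} {k} {k ℕ.^ 3} n≤ak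
      (*-mono-≤-rescale {a = b} {c * (d * 1)} {k} {k ℕ.^ 2} n≤bk
        (*-mono-≤-rescale {a = c} {d * 1} {k} {k ℕ.^ 1} n≤ck
          (*-mono-≤-rescale {a = d} {1} {k} {1} n≤dk ℕ.≤-refl)))

family : ℕ → Fin 4
family 0 = 0F
family 1 = 1F
family 2 = 2F
family 3 = 3F
family (suc (suc (suc (suc i)))) = family i

label : ℕ → ℕ
label (suc (suc (suc (suc i)))) = suc (label i)
label _                         = 0

label*4+family≡id : ∀ i → label i ℕ.* 4 ℕ.+ toℕ (family i) ≡ i
label*4+family≡id 0 = refl
label*4+family≡id 1 = refl
label*4+family≡id 2 = refl
label*4+family≡id 3 = refl
label*4+family≡id (suc (suc (suc (suc i)))) = cong (4 ℕ.+_) (label*4+family≡id i)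

family-label-injective : ∀ {i j} → family i ≡ family j → label i ≡ label j → i ≡ j
family-label-injective {i} {j} fi≡fj li≡lj = begin
  i                                  ≡⟨ sym (label*4+family≡id i) ⟩
  label i ℕ.* 4 ℕ.+ toℕ (family i)   ≡⟨ cong₂ (λ l f → l ℕ.* 4 ℕ.+ toℕ f) li≡lj fi≡fj ⟩
  label j ℕ.* 4 ℕ.+ toℕ (family j)   ≡⟨ label*4+family≡id j ⟩
  j                                  ∎
  where open ≡-Reasoning

familySize : Fin 4 → ℕ → ℕ
familySize X n = countFin (λ (i : Fin n) → family (toℕ i) Fin.≟ X)

familySize-+4 : ∀ X n → familySize X (4 ℕ.+ n) ≡ suc (familySize X n)
familySize-+4 0F n = refl
familySize-+4 1F n = refl
familySize-+4 2F n = refl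
familySize-+4 3F n = refl

≤3+familySize*4 : ∀ X n → n ℕ.≤ 3 ℕ.+ familySize X n ℕ.* 4
≤3+familySize*4 X 0 = z≤n
≤3+familySize*4 X 1 = s≤s z≤n
≤3+familySize*4 X 2 = s≤s (s≤s z≤n)
≤3+familySize*4 X 3 = s≤s (s≤s (s≤s z≤n))
≤3+familySize*4 X (suc (suc (suc (suc n)))) rewrite familySize-+4 X n =
  s≤s (s≤s (s≤s (s≤s (≤3+familySize*4 X n))))

≤familySize*7 : ∀ X {n} → 3 ℕ.< n → n ℕ.≤ familySize X n ℕ.* 7
≤familySize*7 X {n@(suc (suc (suc (suc m))))} (s≤s (s≤s (s≤s (s≤s _)))) = begin
  n                      ≤⟨ ≤3+familySize*4 X n ⟩
  3 ℕ.+ s ℕ.* 4          ≤⟨ ℕ.+-monoˡ-≤ (s ℕ.* 4) 3≤s*3 ⟩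
  s ℕ.* 3 ℕ.+ s ℕ.* 4    ≡⟨ sym (ℕ.*-distribˡ-+ s 3 4) ⟩
  s ℕ.* 7                ∎
  where
  open ℕ.≤-Reasoning
  s : ℕ
  s = familySize X n
  3≤s*3 : 3 ℕ.≤ s ℕ.* 3
  3≤s*3 rewrite familySize-+4 X m = ℕ.m≤m+n 3 _

module RightPaths (ℝ : RealField) where
  open Counting ℝ

  RightPath : ∀ {d} → Point d → Point d → Point d → Point d → Set
  RightPath x y z w = RightAngle x y z × RightAngle y z w

  rightPathCount-≤ : ∀ {d n} (E : Fin n → Point d) → rightPathCount E ℕ.≤ n ℕ.^ 4
  rightPathCount-≤ {n = n} E =
    sumFin-≤-* n λ i → sumFin-≤-* n λ j → sumFin-≤-* n λ k → sumFin-≤-* n λ l →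
      indicator-≤-1 (rightAngle? (E i) (E j) (E k) ×-dec rightAngle? (E j) (E k) (E l))

  rightPathCount-≥ : ∀ {d n} (E : Fin n → Point d) {P Q R S : Fin n → Set}
                     (P? : ∀ i → Dec (P i)) (Q? : ∀ j → Dec (Q j)) (R? : ∀ k → Dec (R k)) (S? : ∀ l → Dec (S l)) →
                     (∀ {i j k l} → P i → Q j → R k → S l → RightPath (E i) (E j) (E k) (E l)) →
                     countFin P? ℕ.* (countFin Q? ℕ.* (countFin R? ℕ.* (countFin S? ℕ.* 1))) ℕ.≤ rightPathCount E
  rightPathCount-≥ {n = n} E P? Q? R? S? path =
    countFin-*-≤-sumFin n P? λ i p → countFin-*-≤-sumFin n Q? λ j q →
    countFin-*-≤-sumFin n R? λ k r → countFin-*-≤-sumFin n S? λ l s →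
      indicator-≥-1 (rightAngle? (E i) (E j) (E k) ×-dec rightAngle? (E j) (E k) (E l)) (path p q r s)

module Construction (ℝ : RealField) where
  open Counting ℝ
  open OrderedFieldProperties ℝ
  open RightPaths ℝ

  0<1+t² : ∀ t → 0r < 1r + t * t
  0<1+t² t = 0<x∧0≤y⇒0<x+y 0<1 (0≤x*x t)

  module _ (t : Carrier) where
    private
      w : Carrier
      w = proj₁ (positiveInverse (0<1+t² t))

      0<w : 0r < w
      0<w = proj₁ (proj₂ (positiveInverse (0<1+t² t)))

      [1+t²]*w≡1 : (1r + t * t) * w ≡ 1r
      [1+t²]*w≡1 = proj₂ (proj₂ (positiveInverse (0<1+t² t)))

    circleX circleY : Carrier
    circleX = (1r - (t * t)) * w
    circleY = (t + t) * w

    circleX²+circleY²≡1 : circleX * circleX + circleY * circleY ≡ 1r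
    circleX²+circleY²≡1 = begin
      circleX * circleX + circleY * circleY
        ≡⟨ solve 2 (λ t w → ((con 1ℤ :- t :* t) :* w) :* ((con 1ℤ :- t :* t) :* w) :+ ((t :+ t) :* w) :* ((t :+ t) :* w)
                            := ((con 1ℤ :+ t :* t) :* w) :* ((con 1ℤ :+ t :* t) :* w)) refl t w ⟩
      ((1r + t * t) * w) * ((1r + t * t) * w)  ≡⟨ cong₂ _*_ [1+t²]*w≡1 [1+t²]*w≡1 ⟩
      1r * 1r                                  ≡⟨ *-identityˡ 1r ⟩
      1r                                       ∎
      where open ≡-Reasoning

    1+circleX≡2*w : 1r + circleX ≡ (1r + 1r) * w
    1+circleX≡2*w = begin
      1r + (1r - (t * t)) * w                ≡⟨ cong (_+ (1r - (t * t)) * w) (sym [1+t²]*w≡1) ⟩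
      (1r + t * t) * w + (1r - (t * t)) * w  ≡⟨ solve 2 (λ t w → (con 1ℤ :+ t :* t) :* w :+ (con 1ℤ :- t :* t) :* w
                                                               := (con 1ℤ :+ con 1ℤ) :* w) refl t w ⟩
      (1r + 1r) * w                          ∎
      where open ≡-Reasoning

    0<1+circleX : 0r < 1r + circleX
    0<1+circleX = subst (0r <_) (sym 1+circleX≡2*w) (*-pos 0<2 0<w)

    circleY≡[1+circleX]*t : circleY ≡ (1r + circleX) * t
    circleY≡[1+circleX]*t = begin
      (t + t) * w           ≡⟨ solve 2 (λ t w → (t :+ t) :* w := ((con 1ℤ :+ con 1ℤ) :* w) :* t) refl t w ⟩
      ((1r + 1r) * w) * t   ≡⟨ cong (_* t) (sym 1+circleX≡2*w) ⟩
      (1r + circleX) * t    ∎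
      where open ≡-Reasoning

  circle-injective : ∀ {s t} → 1r + circleX s ≡ 1r + circleX t → circleY s ≡ circleY t → s ≡ t
  circle-injective {s} {t} 1+Xs≡1+Xt Ys≡Yt = *-cancelˡ (0<⇒≢0 (0<1+circleX s)) (begin
    (1r + circleX s) * s   ≡⟨ sym (circleY≡[1+circleX]*t s) ⟩
    circleY s              ≡⟨ Ys≡Yt ⟩
    circleY t              ≡⟨ circleY≡[1+circleX]*t t ⟩
    (1r + circleX t) * t   ≡⟨ cong (_* t) (sym 1+Xs≡1+Xt) ⟩
    (1r + circleX s) * t   ∎)
    where open ≡-Reasoning

  point : Fin 4 → ℕ → Point 5
  point 0F k = - 1r              ∷ 0r                ∷ 0r                     ∷ 0r                ∷ fromℕ (suc k) ∷ []
  point 1F k = circleX (fromℕ k) ∷ circleY (fromℕ k) ∷ 0r                     ∷ 0r                ∷ 0r            ∷ []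
  point 2F k = 1r                ∷ 0r                ∷ 1r + circleX (fromℕ k) ∷ circleY (fromℕ k) ∷ 0r            ∷ []
  point 3F k = 1r                ∷ 0r                ∷ 1r + 1r                ∷ 0r                ∷ fromℕ (suc k) ∷ []

  coordinate : ∀ {p q : Point 5} (i : Fin 5) → p ≡ q → lookup p i ≡ lookup q i
  coordinate i = cong (λ p → lookup p i)

  rightAngle-012 : ∀ a b c → RightAngle (point 0F a) (point 1F b) (point 2F c)
  rightAngle-012 a b c =
    (λ e → 0<⇒≢0 (0<fromℕ-suc a) (coordinate 4F e)) ,
    (λ e → 0<⇒≢0 (0<1+circleX (fromℕ c)) (coordinate 2F e)) ,
    (begin
      dot (point 0F a ⊖ point 1F b) (point 2F c ⊖ point 1F b)
        -- the left-hand side of the polynomial identity is `dot` unfolded verbatim, so that `refl` closes it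
        ≡⟨ solve 5 (λ s x y z w →
             (con -1ℤ :- x) :* (con 1ℤ :- x) :+ ((con 0ℤ :- y) :* (con 0ℤ :- y) :+ ((con 0ℤ :- con 0ℤ) :* (z :- con 0ℤ)
               :+ ((con 0ℤ :- con 0ℤ) :* (w :- con 0ℤ) :+ ((s :- con 0ℤ) :* (con 0ℤ :- con 0ℤ) :+ con 0ℤ))))
             := x :* x :+ y :* y :- con 1ℤ) refl
             (fromℕ (suc a)) (circleX (fromℕ b)) (circleY (fromℕ b)) (1r + circleX (fromℕ c)) (circleY (fromℕ c)) ⟩
      (circleX (fromℕ b) * circleX (fromℕ b) + circleY (fromℕ b) * circleY (fromℕ b)) - 1r
        ≡⟨ cong (_- 1r) (circleX²+circleY²≡1 (fromℕ b)) ⟩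
      1r - 1r
        ≡⟨ -‿inverseʳ 1r ⟩
      0r ∎)
    where open ≡-Reasoning

  rightAngle-123 : ∀ b c d → RightAngle (point 1F b) (point 2F c) (point 3F d)
  rightAngle-123 b c d =
    (λ e → 0<⇒≢0 (0<1+circleX (fromℕ c)) (sym (coordinate 2F e))) ,
    (λ e → 0<⇒≢0 (0<fromℕ-suc d) (coordinate 4F e)) ,
    (begin
      dot (point 1F b ⊖ point 2F c) (point 3F d ⊖ point 2F c)
        ≡⟨ solve 5 (λ x y x′ y′ s →
             (x :- con 1ℤ) :* (con 1ℤ :- con 1ℤ) :+ ((y :- con 0ℤ) :* (con 0ℤ :- con 0ℤ)
               :+ ((con 0ℤ :- (con 1ℤ :+ x′)) :* ((con 1ℤ :+ con 1ℤ) :- (con 1ℤ :+ x′))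
               :+ ((con 0ℤ :- y′) :* (con 0ℤ :- y′) :+ ((con 0ℤ :- con 0ℤ) :* (s :- con 0ℤ) :+ con 0ℤ))))
             := x′ :* x′ :+ y′ :* y′ :- con 1ℤ) refl
             (circleX (fromℕ b)) (circleY (fromℕ b)) (circleX (fromℕ c)) (circleY (fromℕ c)) (fromℕ (suc d)) ⟩
      (circleX (fromℕ c) * circleX (fromℕ c) + circleY (fromℕ c) * circleY (fromℕ c)) - 1r
        ≡⟨ cong (_- 1r) (circleX²+circleY²≡1 (fromℕ c)) ⟩
      1r - 1r
        ≡⟨ -‿inverseʳ 1r ⟩
      0r ∎)
    where open ≡-Reasoning

  rightPath : ∀ {W X Y Z} → W ≡ 0F → X ≡ 1F → Y ≡ 2F → Z ≡ 3F →
              ∀ a b c d → RightPath (point W a) (point X b) (point Y c) (point Z d)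
  rightPath refl refl refl refl a b c d = rightAngle-012 a b c , rightAngle-123 b c d

  point-injective : ∀ {X Y k l} → point X k ≡ point Y l → X ≡ Y × k ≡ l
  point-injective {0F} {0F} e = refl , ℕ.suc-injective (fromℕ-injective (coordinate 4F e))
  point-injective {0F} {1F} {k} e = ⊥-elim (0<⇒≢0 (0<fromℕ-suc k) (coordinate 4F e))
  point-injective {0F} {2F} {k} e = ⊥-elim (0<⇒≢0 (0<fromℕ-suc k) (coordinate 4F e))
  point-injective {0F} {3F} e = ⊥-elim (-1≢1 (coordinate 0F e))
  point-injective {1F} {0F} {l = l} e = ⊥-elim (0<⇒≢0 (0<fromℕ-suc l) (sym (coordinate 4F e)))
  point-injective {1F} {1F} e = refl , fromℕ-injective (circle-injective (cong (1r +_) (coordinate 0F e)) (coordinate 1F e))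
  point-injective {1F} {2F} {l = l} e = ⊥-elim (0<⇒≢0 (0<1+circleX (fromℕ l)) (sym (coordinate 2F e)))
  point-injective {1F} {3F} {l = l} e = ⊥-elim (0<⇒≢0 (0<fromℕ-suc l) (sym (coordinate 4F e)))
  point-injective {2F} {0F} {l = l} e = ⊥-elim (0<⇒≢0 (0<fromℕ-suc l) (sym (coordinate 4F e)))
  point-injective {2F} {1F} {k} e = ⊥-elim (0<⇒≢0 (0<1+circleX (fromℕ k)) (coordinate 2F e))
  point-injective {2F} {2F} e = refl , fromℕ-injective (circle-injective (coordinate 2F e) (coordinate 3F e))
  point-injective {2F} {3F} {l = l} e = ⊥-elim (0<⇒≢0 (0<fromℕ-suc l) (sym (coordinate 4F e)))
  point-injective {3F} {0F} e = ⊥-elim (-1≢1 (sym (coordinate 0F e)))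
  point-injective {3F} {1F} {k} e = ⊥-elim (0<⇒≢0 (0<fromℕ-suc k) (coordinate 4F e))
  point-injective {3F} {2F} {k} e = ⊥-elim (0<⇒≢0 (0<fromℕ-suc k) (coordinate 4F e))
  point-injective {3F} {3F} e = refl , ℕ.suc-injective (fromℕ-injective (coordinate 4F e))

  configuration : (n : ℕ) → Fin n → Point 5
  configuration n i = point (family (toℕ i)) (label (toℕ i))

  configuration-injective : ∀ n → Injective _≡_ _≡_ (configuration n)
  configuration-injective n e with point-injective e
  ... | fi≡fj , li≡lj = Fin.toℕ-injective (family-label-injective fi≡fj li≡lj)

  configuration-rightPathCount : ∀ {n} → 3 ℕ.< n → n ℕ.^ 4 ℕ.≤ rightPathCount (configuration n) ℕ.* 7 ℕ.^ 4
  configuration-rightPathCount {n} 3<n = begin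
    n ℕ.^ 4
      ≤⟨ ^4-≤-rescale {k = 7} {size 0F} {size 1F} {size 2F} {size 3F} (≤familySize*7 0F 3<n) (≤familySize*7 1F 3<n) (≤familySize*7 2F 3<n) (≤familySize*7 3F 3<n) ⟩
    (size 0F ℕ.* (size 1F ℕ.* (size 2F ℕ.* (size 3F ℕ.* 1)))) ℕ.* 7 ℕ.^ 4
      ≤⟨ ℕ.*-monoˡ-≤ (7 ℕ.^ 4) (rightPathCount-≥ (configuration n) (inFamily 0F) (inFamily 1F) (inFamily 2F) (inFamily 3F)
                               λ p q r s → rightPath p q r s _ _ _ _) ⟩
    rightPathCount (configuration n) ℕ.* 7 ℕ.^ 4 ∎
    where
    open ℕ.≤-Reasoning
    size : Fin 4 → ℕ
    size X = familySize X n
    inFamily : ∀ X (i : Fin n) → Dec (family (toℕ i) ≡ X)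
    inFamily X i = family (toℕ i) Fin.≟ X

theorem5p1 : (ℝ : RealField) → let open Counting ℝ in
    ∃ λ (c : Carrier) → ∃ λ (C : Carrier) → ∃ λ (N : ℕ) →
      (0r < c) × (0r < C) ×
      (∀ (n : ℕ) → n > N →
        ∃ λ (E : Fin n → Point 5) → Injective _≡_ _≡_ E ×
          (c * fromℕ (n ^ 4) ≤ fromℕ (rightPathCount E)) ×
          (fromℕ (rightPathCount E) ≤ C * fromℕ (n ^ 4)))
theorem5p1 ℝ =
  let (c , 0<c , 7⁴*c≡1) = positiveInverse (0<fromℕ (ℕ.m^n>0 7 4)) in
  c , 1r , 3 , 0<c , 0<1 , λ n 3<n →
    configuration n , configuration-injective n ,
    fromℕ-≤-rescale {r = rightPathCount (configuration n)} 0<c 7⁴*c≡1 (configuration-rightPathCount 3<n) ,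
    subst (fromℕ (rightPathCount (configuration n)) ≤_) (sym (*-identityˡ _)) (fromℕ-mono-≤ (rightPathCount-≤ (configuration n)))
  where
  open Counting ℝ
  open OrderedFieldProperties ℝ
  open RightPaths ℝ
  open Construction ℝ
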